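{- Let $n$ be a positive integer and let $\mathcal{S}$ be a Steiner triple system on an $n$-element set $X$. Let $p\ge 0$ be an integer and let $B_1,\dots,B_p\in\mathcal{S}$ be pairwise disjoint triples of $\mathcal{S}$, with union $V=B_1\cup\dots\cup B_p$. Then the number of triples of $\mathcal{S}$ that intersect $V$ is at most $$s(p)=3p\left(\frac{n-1}{2}-\frac{3p-1}{3}\right).$$
   Context: A Steiner triple system (STS) of order $n$ on an $n$-element set $X$ is a set $\mathcal{S}$ of $3$-element subsets (triples) of $X$ such that every pair of distinct elements of $X$ is contained in exactly one triple of $\mathcal{S}$. A triple "intersects" $V$ if it has nonempty intersection with $V$. -}

module Defs where

open import Data.Nat using (ℕ; _+_; _*_; _∸_; _≤_)
open import Data.Fin using (Fin)
open import Data.Fin.Subset using (Subset; _∈_; _∩_; _∪_; ⊥; ∣_∣; Empty; Nonempty)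
open import Data.List using (List; filter; length)
open import Data.List.Relation.Unary.Unique.Propositional using (Unique)
open import Data.List.Relation.Unary.All using (All)
import Data.List.Membership.Propositional as LM
open import Relation.Binary.PropositionalEquality using (_≡_; _≢_)
open import Relation.Nullary using (¬_)
open import Data.Product using (_×_; ∃-syntax)
open import Relation.Nullary.Decidable using (¬?)
open import Data.Fin.Subset.Properties using (nonempty?)

record STS (n : ℕ) : Set where
  field
    triples    : List (Subset n)
    distinct   : Unique triples
    are-triples : All (λ B → ∣ B ∣ ≡ 3) triples
    covers     : ∀ (x y : Fin n) → x ≢ y →
                   ∃[ B ] (B LM.∈ triples × x ∈ B × y ∈ B)
    unique     : ∀ (x y : Fin n) → x ≢ y → ∀ B C →
                   B LM.∈ triples → x ∈ B → y ∈ B →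
                   C LM.∈ triples → x ∈ C → y ∈ C → B ≡ C
open STS public

Intersects : ∀ {n} → Subset n → Subset n → Set
Intersects B V = Nonempty (B ∩ V)

⋃ : ∀ {n} (p : ℕ) → (Fin p → Subset n) → Subset n
⋃ ℕ.zero    B = ⊥
⋃ (ℕ.suc p) B = B Fin.zero ∪ ⋃ p (λ i → B (Fin.suc i))

numIntersecting : ∀ {n} → STS n → Subset n → ℕ
numIntersecting S V = length (filter (λ B → nonempty? (B ∩ V)) (triples S))

module Submission where

-- Index the triples as T₀,…,T_{t-1}, let V
-- be ANY set of m points, kᵢ = |Tᵢ ∩ V|, K = Σkᵢ, Q = Σkᵢ², and C the number of
-- triples meeting V.  Three counts are combined:
--   * every point lies on (n-1)/2 triples (first moment):      2K + m = m·n;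
--   * each pair of distinct points lies on one triple
--     (second moment, Q - K = m(m-1)):                          Q + m = m² + K;
--   * 0 ≤ kᵢ ≤ 3 gives 3·[kᵢ ≥ 1] + kᵢ² ≤ 4kᵢ, hence            3C + Q ≤ 4K.
-- Eliminating K and Q yields 6C + 2m² + m ≤ 3mn for every V (meeting-bound).
-- Disjointness of B₁,…,B_p is used only to get m = 3p, turning this into 2s(p).

open import Defs
open import Data.Nat using (ℕ; _+_; _*_; _∸_; _≤_; NonZero)
open import Data.Fin using (Fin)
open import Data.Fin.Subset using (Subset; _∩_; Empty)
import Data.List.Membership.Propositional as LM
open import Relation.Binary.PropositionalEquality using (_≢_)

open import Data.Nat using (zero; suc; z≤n; s≤s)
open import Data.Nat.Properties
  using (+-*-semiring; +-assoc; +-suc; +-identityʳ; *-assoc; *-comm; *-identityˡ; *-identityʳ;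
         *-distribˡ-+; +-cancelʳ-≡; ≤-refl; ≤-reflexive; ≤-trans; n≤1+n; m≤m+n; +-mono-≤; +-monoˡ-≤;
         *-monoˡ-≤; *-monoʳ-≤; +-cancelʳ-≤; *-cancelˡ-≤; module ≤-Reasoning)
open import Data.Nat.Tactic.RingSolver using (solve-∀)
open import Data.Fin using (zero; suc; punchIn)
import Data.Fin.Properties as Fin using (suc-injective; punchInᵢ≢i)
open import Data.Fin.Subset using (_∪_; ∣_∣; Nonempty; _∈_; ⁅_⁆; inside; outside)
open import Data.Fin.Subset.Properties
  using (_∈?_; nonempty?; x∈p∩q⁺; x∈p∩q⁻; x∈p∪q⁻; ∉⊥; ∣⊥∣≡0; drop-∷-Empty; ∣⁅x⁆∣≡1; x∈⁅y⁆⇒x≡y; p⊆q⇒∣p∣≤∣q∣; ∣p∩q∣≤∣p∣)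
open import Data.Bool using (true; false; if_then_else_)
open import Data.Vec using ([]; _∷_; here)
open import Data.List using (List; []; _∷_; filter; length)
import Data.List as List
open import Data.List.Membership.Propositional.Properties using (∈-lookup)
open import Data.List.Relation.Unary.All as All using ()
open import Data.List.Relation.Unary.Any as Any using ()
open import Data.List.Relation.Unary.Any.Properties using (lookup-index)
open import Data.List.Relation.Unary.AllPairs using (_∷_)
open import Data.List.Relation.Unary.Unique.Propositional using (Unique)
open import Data.Product using (_×_; _,_; ∃-syntax; proj₁; proj₂)
open import Data.Sum using (inj₁; inj₂)
open import Function using (_∘_)
open import Relation.Nullary using (¬_; Dec; yes; no; does; contradiction)
open import Relation.Unary using (Decidable)
open import Relation.Binary.PropositionalEquality
  using (_≡_; refl; sym; trans; cong; cong₂; subst; module ≡-Reasoning)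
open import Algebra.Properties.Semiring.Sum +-*-semiring
  using (sum; sum-syntax; sum-cong-≗; sum-remove; sum-replicate-zero; ∑-comm; ∑-distrib-+;
         *-distribˡ-sum; *-distribʳ-sum)

𝟙 : ∀ {p} {P : Set p} → Dec P → ℕ
𝟙 d = if does d then 1 else 0

𝟙-idem : ∀ {p} {P : Set p} (d : Dec P) → 𝟙 d * 𝟙 d ≡ 𝟙 d
𝟙-idem (yes _) = refl
𝟙-idem (no _)  = refl

sum-mono : ∀ {n} {f g : Fin n → ℕ} → (∀ i → f i ≤ g i) → sum f ≤ sum g
sum-mono {zero}  f≤g = z≤n
sum-mono {suc n} f≤g = +-mono-≤ (f≤g zero) (sum-mono (f≤g ∘ suc))

sum-ones : ∀ n → ∑[ i < n ] 1 ≡ n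
sum-ones zero    = refl
sum-ones (suc n) = cong suc (sum-ones n)

sum-agree-off : ∀ {n} (u v : Fin n → ℕ) (i : Fin n) →
  (∀ j → j ≢ i → u j ≡ v j) → sum u + v i ≡ sum v + u i
sum-agree-off {suc n} u v i agree = begin
  sum u + v i                          ≡⟨ cong (_+ v i) (sum-remove {i = i} u) ⟩
  u i + sum (u ∘ punchIn i) + v i      ≡⟨ cong (λ s → u i + s + v i) rest ⟩
  u i + sum (v ∘ punchIn i) + v i      ≡⟨ exchange (u i) (sum (v ∘ punchIn i)) (v i) ⟩
  v i + sum (v ∘ punchIn i) + u i      ≡⟨ cong (_+ u i) (sym (sum-remove {i = i} v)) ⟩
  sum v + u i                          ∎
  where
  open ≡-Reasoning
  rest : sum (u ∘ punchIn i) ≡ sum (v ∘ punchIn i)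
  rest = sum-cong-≗ (λ j → agree (punchIn i j) (Fin.punchInᵢ≢i i j))
  exchange : ∀ a s b → a + s + b ≡ b + s + a
  exchange = solve-∀

sum-single : ∀ {n} (u : Fin n → ℕ) (i : Fin n) → (∀ j → j ≢ i → u j ≡ 0) → sum u ≡ u i
sum-single {n} u i vanish = begin
  sum u                 ≡⟨ sym (+-identityʳ (sum u)) ⟩
  sum u + 0             ≡⟨ sum-agree-off u (λ _ → 0) i vanish ⟩
  ∑[ j < n ] 0 + u i    ≡⟨ cong (_+ u i) (sum-replicate-zero n) ⟩
  u i                   ∎
  where open ≡-Reasoning

bilinear-swap : ∀ {s t} (a : Fin s → ℕ) (b : Fin t → ℕ) (M : Fin s → Fin t → ℕ) →
  ∑[ i < s ] (a i * ∑[ j < t ] (b j * M i j)) ≡ ∑[ j < t ] (b j * ∑[ i < s ] (a i * M i j))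
bilinear-swap {s} {t} a b M = begin
  ∑[ i < s ] (a i * ∑[ j < t ] (b j * M i j))   ≡⟨ sum-cong-≗ (λ i → *-distribˡ-sum (a i) (λ j → b j * M i j)) ⟩
  ∑[ i < s ] ∑[ j < t ] (a i * (b j * M i j))   ≡⟨ sum-cong-≗ (λ i → sum-cong-≗ (λ j → regroup (a i) (b j) (M i j))) ⟩
  ∑[ i < s ] ∑[ j < t ] (b j * (a i * M i j))   ≡⟨ ∑-comm (λ i j → b j * (a i * M i j)) ⟩
  ∑[ j < t ] ∑[ i < s ] (b j * (a i * M i j))   ≡⟨ sum-cong-≗ (λ j → sym (*-distribˡ-sum (b j) (λ i → a i * M i j))) ⟩
  ∑[ j < t ] (b j * ∑[ i < s ] (a i * M i j))   ∎
  where
  open ≡-Reasoning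
  regroup : ∀ x y z → x * (y * z) ≡ y * (x * z)
  regroup = solve-∀

length-filter : ∀ {a p} {A : Set a} {P : A → Set p} (P? : Decidable P) (xs : List A) →
  length (filter P? xs) ≡ ∑[ i < length xs ] 𝟙 (P? (List.lookup xs i))
length-filter P? []       = refl
length-filter P? (x ∷ xs) with does (P? x)
... | true  = cong suc (length-filter P? xs)
... | false = length-filter P? xs

lookup-injective : ∀ {a} {A : Set a} {xs : List A} → Unique xs →
  ∀ i j → List.lookup xs i ≡ List.lookup xs j → i ≡ j
lookup-injective {xs = _ ∷ _} _            zero    zero    _  = refl
lookup-injective {xs = _ ∷ _} (x∉xs ∷ _)   zero    (suc j) eq = contradiction eq (All.lookup x∉xs (∈-lookup j))
lookup-injective {xs = _ ∷ _} (x∉xs ∷ _)   (suc i) zero    eq = contradiction (sym eq) (All.lookup x∉xs (∈-lookup i))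
lookup-injective {xs = _ ∷ _} (_ ∷ unique) (suc i) (suc j) eq = cong suc (lookup-injective unique i j eq)

χ : ∀ {n} → Subset n → Fin n → ℕ
χ A x = 𝟙 (x ∈? A)

∣∣≡sum-χ : ∀ {n} (A : Subset n) → ∣ A ∣ ≡ sum (χ A)
∣∣≡sum-χ []            = refl
∣∣≡sum-χ (inside ∷ A)  = cong suc (∣∣≡sum-χ A)
∣∣≡sum-χ (outside ∷ A) = ∣∣≡sum-χ A

χ-∩ : ∀ {n} (A C : Subset n) x → χ (A ∩ C) x ≡ χ A x * χ C x
χ-∩ A C x with x ∈? A | x ∈? C | x ∈? A ∩ C
... | yes _   | yes _   | yes _    = refl
... | yes x∈A | yes x∈C | no x∉A∩C = contradiction (x∈p∩q⁺ (x∈A , x∈C)) x∉A∩C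
... | no x∉A  | _       | yes x∈A∩C = contradiction (proj₁ (x∈p∩q⁻ A C x∈A∩C)) x∉A
... | yes _   | no x∉C  | yes x∈A∩C = contradiction (proj₂ (x∈p∩q⁻ A C x∈A∩C)) x∉C
... | yes _   | no _    | no _     = refl
... | no _    | _       | no _     = refl

χ-∈ : ∀ {n} {A : Subset n} {x} → x ∈ A → χ A x ≡ 1
χ-∈ {A = A} {x} x∈A with x ∈? A
... | yes _   = refl
... | no x∉A  = contradiction x∈A x∉A

χ-pair : ∀ {n} (A : Subset n) x y → ¬ (x ∈ A × y ∈ A) → χ A x * χ A y ≡ 0
χ-pair A x y not-both with x ∈? A | y ∈? A
... | yes x∈A | yes y∈A = contradiction (x∈A , y∈A) not-both
... | yes _   | no _    = refl
... | no _    | _       = refl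

nonempty⇒1≤∣∣ : ∀ {n} {A : Subset n} → Nonempty A → 1 ≤ ∣ A ∣
nonempty⇒1≤∣∣ {A = A} (x , x∈A) =
  subst (_≤ ∣ A ∣) (∣⁅x⁆∣≡1 x) (p⊆q⇒∣p∣≤∣q∣ ⁅x⁆⊆A)
  where
  ⁅x⁆⊆A : ∀ {y} → y ∈ ⁅ x ⁆ → y ∈ A
  ⁅x⁆⊆A y∈⁅x⁆ = subst (_∈ A) (sym (x∈⁅y⁆⇒x≡y x y∈⁅x⁆)) x∈A

∣∪∣-disjoint : ∀ {n} (A C : Subset n) → Empty (A ∩ C) → ∣ A ∪ C ∣ ≡ ∣ A ∣ + ∣ C ∣
∣∪∣-disjoint []            []            _    = refl
∣∪∣-disjoint (inside ∷ A)  (inside ∷ C)  disj = contradiction (zero , here) disj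
∣∪∣-disjoint (inside ∷ A)  (outside ∷ C) disj = cong suc (∣∪∣-disjoint A C (drop-∷-Empty disj))
∣∪∣-disjoint (outside ∷ A) (inside ∷ C)  disj =
  trans (cong suc (∣∪∣-disjoint A C (drop-∷-Empty disj))) (sym (+-suc ∣ A ∣ ∣ C ∣))
∣∪∣-disjoint (outside ∷ A) (outside ∷ C) disj = ∣∪∣-disjoint A C (drop-∷-Empty disj)

∈-⋃ : ∀ {n} p (B : Fin p → Subset n) {x} → x ∈ ⋃ p B → ∃[ i ] x ∈ B i
∈-⋃ zero    B x∈⋃ = contradiction x∈⋃ ∉⊥
∈-⋃ (suc p) B x∈⋃ with x∈p∪q⁻ (B zero) (⋃ p (B ∘ suc)) x∈⋃
... | inj₁ x∈B₀   = zero , x∈B₀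
... | inj₂ x∈rest with ∈-⋃ p (B ∘ suc) x∈rest
...   | i , x∈Bᵢ  = suc i , x∈Bᵢ

∣⋃∣ : ∀ {n} p (B : Fin p → Subset n) {k} → (∀ i → ∣ B i ∣ ≡ k) →
  (∀ i j → i ≢ j → Empty (B i ∩ B j)) → ∣ ⋃ p B ∣ ≡ p * k
∣⋃∣ {n} zero B size pairwise = ∣⊥∣≡0 n
∣⋃∣ (suc p) B size pairwise =
  trans (∣∪∣-disjoint (B zero) (⋃ p (B ∘ suc)) B₀-disjoint)
        (cong₂ _+_ (size zero) (∣⋃∣ p (B ∘ suc) (size ∘ suc) pairwise-rest))
  where
  pairwise-rest : ∀ i j → i ≢ j → Empty (B (suc i) ∩ B (suc j))
  pairwise-rest i j i≢j = pairwise (suc i) (suc j) (i≢j ∘ Fin.suc-injective)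
  B₀-disjoint : Empty (B zero ∩ ⋃ p (B ∘ suc))
  B₀-disjoint (x , x∈) with x∈p∩q⁻ (B zero) _ x∈
  ... | x∈B₀ , x∈rest with ∈-⋃ p (B ∘ suc) x∈rest
  ...   | i , x∈Bᵢ = pairwise zero (suc i) (λ ()) (x , x∈p∩q⁺ (x∈B₀ , x∈Bᵢ))

-- Incidence structures given by an indexed family of blocks

module Incidence {n t : ℕ} (T : Fin t → Subset n) where

  degree : Fin n → ℕ
  degree x = ∑[ i < t ] χ (T i) x

  pairCount : Fin n → Fin n → ℕ
  pairCount x y = ∑[ i < t ] (χ (T i) x * χ (T i) y)

  weight : (Fin n → ℕ) → Fin t → ℕ
  weight f i = ∑[ y < n ] (f y * χ (T i) y)

  pairCount-diagonal : ∀ x → pairCount x x ≡ degree x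
  pairCount-diagonal x = sum-cong-≗ (λ i → 𝟙-idem (x ∈? T i))

  total-weight : ∀ f → ∑[ i < t ] weight f i ≡ ∑[ y < n ] (f y * degree y)
  total-weight f = begin
    ∑[ i < t ] weight f i                             ≡⟨ sum-cong-≗ (λ i → sym (*-identityˡ (weight f i))) ⟩
    ∑[ i < t ] (1 * weight f i)                       ≡⟨ bilinear-swap (λ _ → 1) f (λ i → χ (T i)) ⟩
    ∑[ y < n ] (f y * ∑[ i < t ] (1 * χ (T i) y))    ≡⟨ sum-cong-≗ (λ y → cong (f y *_) (sum-cong-≗ (λ i → *-identityˡ (χ (T i) y)))) ⟩
    ∑[ y < n ] (f y * degree y)                       ∎
    where open ≡-Reasoning

  weight-through : ∀ g x → ∑[ i < t ] (χ (T i) x * weight g i) ≡ ∑[ y < n ] (g y * pairCount x y)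
  weight-through g x = bilinear-swap (λ i → χ (T i) x) g (λ i → χ (T i))

  module Linear (pair-once : ∀ x y → x ≢ y → pairCount x y ≡ 1) where

    -- The blocks through x cover every other point exactly once.
    row-identity : ∀ g x → ∑[ i < t ] (χ (T i) x * weight g i) + g x ≡ sum g + g x * degree x
    row-identity g x = begin
      ∑[ i < t ] (χ (T i) x * weight g i) + g x   ≡⟨ cong (_+ g x) (weight-through g x) ⟩
      ∑[ y < n ] (g y * pairCount x y) + g x      ≡⟨ sum-agree-off (λ y → g y * pairCount x y) g x off-diagonal ⟩
      sum g + g x * pairCount x x                 ≡⟨ cong (λ c → sum g + g x * c) (pairCount-diagonal x) ⟩
      sum g + g x * degree x                      ∎
      where
      open ≡-Reasoning
      off-diagonal : ∀ y → y ≢ x → g y * pairCount x y ≡ g y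
      off-diagonal y y≢x = trans (cong (g y *_) (pair-once x y (y≢x ∘ sym))) (*-identityʳ (g y))

    second-moment : ∀ f g →
      ∑[ i < t ] (weight g i * weight f i) + ∑[ x < n ] (f x * g x)
        ≡ sum f * sum g + ∑[ x < n ] (f x * (g x * degree x))
    second-moment f g = begin
      ∑[ i < t ] (weight g i * weight f i) + ∑[ x < n ] (f x * g x)
        ≡⟨ cong (_+ ∑[ x < n ] (f x * g x)) (bilinear-swap (weight g) f (λ i → χ (T i))) ⟩
      ∑[ x < n ] (f x * through x) + ∑[ x < n ] (f x * g x)
        ≡⟨ sym (∑-distrib-+ (λ x → f x * through x) (λ x → f x * g x)) ⟩
      ∑[ x < n ] (f x * through x + f x * g x)
        ≡⟨ sum-cong-≗ (λ x → trans (sym (*-distribˡ-+ (f x) (through x) (g x))) (cong (f x *_) (row x))) ⟩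
      ∑[ x < n ] (f x * (sum g + g x * degree x))
        ≡⟨ sum-cong-≗ (λ x → *-distribˡ-+ (f x) (sum g) (g x * degree x)) ⟩
      ∑[ x < n ] (f x * sum g + f x * (g x * degree x))
        ≡⟨ ∑-distrib-+ (λ x → f x * sum g) (λ x → f x * (g x * degree x)) ⟩
      ∑[ x < n ] (f x * sum g) + ∑[ x < n ] (f x * (g x * degree x))
        ≡⟨ cong (_+ ∑[ x < n ] (f x * (g x * degree x))) (sym (*-distribʳ-sum (sum g) f)) ⟩
      sum f * sum g + ∑[ x < n ] (f x * (g x * degree x))
        ∎
      where
      open ≡-Reasoning
      through : Fin n → ℕ
      through x = ∑[ i < t ] (weight g i * χ (T i) x)
      row : ∀ x → through x + g x ≡ sum g + g x * degree x
      row x = trans (cong (_+ g x) (sum-cong-≗ (λ i → *-comm (weight g i) (χ (T i) x)))) (row-identity g x)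

    module Triples (block-size : ∀ i → ∣ T i ∣ ≡ 3) where

      degree-formula : ∀ x → 2 * degree x + 1 ≡ n
      degree-formula x = +-cancelʳ-≡ (degree x) (2 * degree x + 1) n (begin
        2 * degree x + 1 + degree x                         ≡⟨ regroup (degree x) ⟩
        degree x * 3 + 1                                    ≡⟨ cong (_+ 1) (*-distribʳ-sum 3 (λ i → χ (T i) x)) ⟩
        ∑[ i < t ] (χ (T i) x * 3) + 1                      ≡⟨ cong (_+ 1) (sum-cong-≗ (λ i → cong (χ (T i) x *_) (sym (size i)))) ⟩
        ∑[ i < t ] (χ (T i) x * weight (λ _ → 1) i) + 1    ≡⟨ row-identity (λ _ → 1) x ⟩
        ∑[ y < n ] 1 + 1 * degree x                         ≡⟨ cong₂ _+_ (sum-ones n) (*-identityˡ (degree x)) ⟩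
        n + degree x                                        ∎)
        where
        open ≡-Reasoning
        regroup : ∀ d → 2 * d + 1 + d ≡ d * 3 + 1
        regroup = solve-∀
        size : ∀ i → weight (λ _ → 1) i ≡ 3
        size i = trans (sum-cong-≗ (λ y → *-identityˡ (χ (T i) y)))
                       (trans (sym (∣∣≡sum-χ (T i))) (block-size i))

      first-moment : ∀ f → 2 * ∑[ i < t ] weight f i + sum f ≡ sum f * n
      first-moment f = begin
        2 * ∑[ i < t ] weight f i + sum f               ≡⟨ cong (λ s → 2 * s + sum f) (total-weight f) ⟩
        2 * ∑[ y < n ] (f y * degree y) + sum f          ≡⟨ cong (_+ sum f) (*-distribˡ-sum 2 (λ y → f y * degree y)) ⟩
        ∑[ y < n ] (2 * (f y * degree y)) + sum f        ≡⟨ sym (∑-distrib-+ (λ y → 2 * (f y * degree y)) f) ⟩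
        ∑[ y < n ] (2 * (f y * degree y) + f y)          ≡⟨ sum-cong-≗ (λ y → trans (factor (f y) (degree y)) (cong (f y *_) (degree-formula y))) ⟩
        ∑[ y < n ] (f y * n)                             ≡⟨ sym (*-distribʳ-sum n f) ⟩
        sum f * n                                        ∎
        where
        open ≡-Reasoning
        factor : ∀ a d → 2 * (a * d) + a ≡ a * (2 * d + 1)
        factor = solve-∀

blocks : ∀ {n} (S : STS n) → Fin (length (triples S)) → Subset n
blocks S = List.lookup (triples S)

blocks-size : ∀ {n} (S : STS n) i → ∣ blocks S i ∣ ≡ 3
blocks-size S i = All.lookup (are-triples S) (∈-lookup i)

-- Two distinct points lie on exactly one indexed block: the block given by
-- covers, at the position where it occurs, and on no block at another
-- position, by uniqueness of the covering triple and distinctness of the list.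
blocks-pair-once : ∀ {n} (S : STS n) x y → x ≢ y → Incidence.pairCount (blocks S) x y ≡ 1
blocks-pair-once S x y x≢y with covers S x y x≢y
... | B , B∈S , x∈B , y∈B =
  trans (sum-single (λ i → χ (T i) x * χ (T i) y) i₀ elsewhere)
        (cong₂ _*_ (χ-∈ (subst (x ∈_) B≡Tᵢ₀ x∈B)) (χ-∈ (subst (y ∈_) B≡Tᵢ₀ y∈B)))
  where
  T = blocks S
  i₀ = Any.index B∈S
  B≡Tᵢ₀ : B ≡ T i₀
  B≡Tᵢ₀ = lookup-index B∈S
  elsewhere : ∀ j → j ≢ i₀ → χ (T j) x * χ (T j) y ≡ 0
  elsewhere j j≢i₀ = χ-pair (T j) x y λ (x∈Tⱼ , y∈Tⱼ) →
    j≢i₀ (lookup-injective (distinct S) j i₀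
      (trans (unique S x y x≢y (T j) B (∈-lookup j) x∈Tⱼ y∈Tⱼ B∈S x∈B y∈B) B≡Tᵢ₀))

numIntersecting-as-sum : ∀ {n} (S : STS n) V →
  numIntersecting S V ≡ ∑[ i < length (triples S) ] 𝟙 (nonempty? (blocks S i ∩ V))
numIntersecting-as-sum S V = length-filter (λ B → nonempty? (B ∩ V)) (triples S)

-- The bound for an arbitrary point set V

block-inequality : ∀ {n} (A : Subset n) → ∣ A ∣ ≤ 3 → 3 * 𝟙 (nonempty? A) + ∣ A ∣ * ∣ A ∣ ≤ 4 * ∣ A ∣
block-inequality A ∣A∣≤3 with nonempty? A
... | yes nonempty = meeting ∣ A ∣ (nonempty⇒1≤∣∣ nonempty) ∣A∣≤3
  where
  meeting : ∀ k → 1 ≤ k → k ≤ 3 → 3 + k * k ≤ 4 * k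
  meeting 1 _ _ = ≤-refl
  meeting 2 _ _ = n≤1+n 7
  meeting 3 _ _ = ≤-refl
  meeting (suc (suc (suc (suc _)))) _ (s≤s (s≤s (s≤s ())))
... | no _ = *-monoˡ-≤ ∣ A ∣ (≤-trans ∣A∣≤3 (n≤1+n 3))

eliminate : ∀ C Q K m n → 2 * K + m ≡ m * n → Q + m ≡ m * m + K → 3 * C + Q ≤ 4 * K →
  6 * C + 2 * m * m + m ≤ 3 * m * n
eliminate C Q K m n first second local = begin
  6 * C + 2 * m * m + m     ≡⟨ regroup₁ C m ⟩
  2 * (3 * C + m * m) + m   ≤⟨ +-monoˡ-≤ m (*-monoʳ-≤ 2 key) ⟩
  2 * (3 * K + m) + m       ≡⟨ regroup₂ K m ⟩
  3 * (2 * K + m)           ≡⟨ cong (3 *_) first ⟩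
  3 * (m * n)               ≡⟨ sym (*-assoc 3 m n) ⟩
  3 * m * n                 ∎
  where
  open ≤-Reasoning
  regroup₁ : ∀ c m → 6 * c + 2 * m * m + m ≡ 2 * (3 * c + m * m) + m
  regroup₁ = solve-∀
  regroup₂ : ∀ k m → 2 * (3 * k + m) + m ≡ 3 * (2 * k + m)
  regroup₂ = solve-∀
  regroup₃ : ∀ k m → 4 * k + m ≡ 3 * k + m + k
  regroup₃ = solve-∀
  key : 3 * C + m * m ≤ 3 * K + m
  key = +-cancelʳ-≤ K (3 * C + m * m) (3 * K + m) (begin
    3 * C + m * m + K     ≡⟨ +-assoc (3 * C) (m * m) K ⟩
    3 * C + (m * m + K)   ≡⟨ cong (3 * C +_) (sym second) ⟩
    3 * C + (Q + m)       ≡⟨ sym (+-assoc (3 * C) Q m) ⟩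
    3 * C + Q + m         ≤⟨ +-monoˡ-≤ m local ⟩
    4 * K + m             ≡⟨ regroup₃ K m ⟩
    3 * K + m + K         ∎)

meeting-bound : ∀ {n} (S : STS n) (V : Subset n) →
  6 * numIntersecting S V + 2 * ∣ V ∣ * ∣ V ∣ + ∣ V ∣ ≤ 3 * ∣ V ∣ * n
meeting-bound {n} S V =
  subst (λ m → 6 * C + 2 * m * m + m ≤ 3 * m * n) (sym (∣∣≡sum-χ V))
        (eliminate C Q K (sum I) n (first-moment I) second local)
  where
  open Incidence (blocks S)
  open Linear (blocks-pair-once S)
  open Triples (blocks-size S)
  open ≤-Reasoning
  t = length (triples S)
  I = χ V
  C = numIntersecting S V
  K = ∑[ i < t ] weight I i
  Q = ∑[ i < t ] (weight I i * weight I i)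

  second : Q + sum I ≡ sum I * sum I + K
  second = begin-equality
    Q + sum I                                        ≡⟨ cong (Q +_) (sum-cong-≗ (λ x → sym (𝟙-idem (x ∈? V)))) ⟩
    Q + ∑[ x < n ] (I x * I x)                       ≡⟨ second-moment I I ⟩
    sum I * sum I + ∑[ x < n ] (I x * (I x * degree x)) ≡⟨ cong (sum I * sum I +_) (trans (sum-cong-≗ idem) (sym (total-weight I))) ⟩
    sum I * sum I + K                                ∎
    where
    idem : ∀ x → I x * (I x * degree x) ≡ I x * degree x
    idem x = trans (sym (*-assoc (I x) (I x) (degree x))) (cong (_* degree x) (𝟙-idem (x ∈? V)))

  weight≡∣∩∣ : ∀ i → weight I i ≡ ∣ blocks S i ∩ V ∣
  weight≡∣∩∣ i = trans (sum-cong-≗ (λ y → trans (*-comm (I y) (χ (blocks S i) y)) (sym (χ-∩ (blocks S i) V y))))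
                       (sym (∣∣≡sum-χ (blocks S i ∩ V)))

  block : ∀ i → 3 * 𝟙 (nonempty? (blocks S i ∩ V)) + weight I i * weight I i ≤ 4 * weight I i
  block i = subst (λ k → 3 * 𝟙 (nonempty? (blocks S i ∩ V)) + k * k ≤ 4 * k) (sym (weight≡∣∩∣ i))
    (block-inequality (blocks S i ∩ V) (≤-trans (∣p∩q∣≤∣p∣ (blocks S i) V) (≤-reflexive (blocks-size S i))))

  local : 3 * C + Q ≤ 4 * K
  local = begin
    3 * C + Q                                                   ≡⟨ cong (λ c → 3 * c + Q) (numIntersecting-as-sum S V) ⟩
    3 * ∑[ i < t ] meets i + Q                                  ≡⟨ cong (_+ Q) (*-distribˡ-sum 3 meets) ⟩
    ∑[ i < t ] (3 * meets i) + Q                                ≡⟨ sym (∑-distrib-+ (λ i → 3 * meets i) (λ i → weight I i * weight I i)) ⟩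
    ∑[ i < t ] (3 * meets i + weight I i * weight I i)          ≤⟨ sum-mono block ⟩
    ∑[ i < t ] (4 * weight I i)                                 ≡⟨ sym (*-distribˡ-sum 4 (weight I)) ⟩
    4 * K                                                       ∎
    where
    meets : Fin t → ℕ
    meets i = 𝟙 (nonempty? (blocks S i ∩ V))

-- meeting-bound at m = 3p (and n ≥ 1) is exactly the inequality 2C ≤ 2·s(p).
rescale : ∀ C p n → 6 * C + 2 * (3 * p) * (3 * p) + 3 * p ≤ 3 * (3 * p) * suc n →
  2 * C + 2 * p * (3 * p ∸ 1) ≤ 3 * p * (suc n ∸ 1)
rescale C zero    n bound = ≤-trans (+-monoˡ-≤ 0 (*-monoˡ-≤ C 2≤6)) (≤-trans (m≤m+n (6 * C + 0) 0) bound)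
  where
  2≤6 : 2 ≤ 6
  2≤6 = s≤s (s≤s z≤n)
rescale C (suc q) n bound = +-cancelʳ-≤ (3 * p) _ _ (*-cancelˡ-≤ 3 (begin
  3 * (2 * C + 2 * p * (3 * p ∸ 1) + 3 * p)     ≡⟨ cong (λ d → 3 * (2 * C + 2 * p * d + 3 * p)) (pred-3p q) ⟩
  3 * (2 * C + 2 * p * (2 + 3 * q) + 3 * p)     ≡⟨ regroup₁ C q ⟩
  6 * C + 2 * (3 * p) * (3 * p) + 3 * p         ≤⟨ bound ⟩
  3 * (3 * p) * suc n                           ≡⟨ regroup₂ q n ⟩
  3 * (3 * p * n + 3 * p)                       ∎))
  where
  open ≤-Reasoning
  p = suc q
  -- 3(q+1) ∸ 1 computes to q + (suc q + (suc q + 0)), a plain polynomial.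
  pred-3p : ∀ q → 3 * suc q ∸ 1 ≡ 2 + 3 * q
  pred-3p q = computed q
    where
    computed : ∀ q → q + (suc q + (suc q + 0)) ≡ 2 + 3 * q
    computed = solve-∀
  regroup₁ : ∀ c q → 3 * (2 * c + 2 * suc q * (2 + 3 * q) + 3 * suc q) ≡ 6 * c + 2 * (3 * suc q) * (3 * suc q) + 3 * suc q
  regroup₁ = solve-∀
  regroup₂ : ∀ q n → 3 * (3 * suc q) * suc n ≡ 3 * (3 * suc q * n + 3 * suc q)
  regroup₂ = solve-∀

proposition2 : (n : ℕ) → .{{_ : NonZero n}} → (S : STS n) → (p : ℕ) →
    (B : Fin p → Subset n) →
    (∀ i → B i LM.∈ triples S) →
    (∀ i j → i ≢ j → Empty (B i ∩ B j)) →
    2 * numIntersecting S (⋃ p B) + 2 * p * (3 * p ∸ 1) ≤ 3 * p * (n ∸ 1)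
proposition2 (suc n) S p B B∈S disjoint = rescale (numIntersecting S V) p n bound
  where
  V = ⋃ p B
  ∣V∣≡3p : ∣ V ∣ ≡ 3 * p
  ∣V∣≡3p = trans (∣⋃∣ p B (λ i → All.lookup (are-triples S) (B∈S i)) disjoint) (*-comm p 3)
  bound : 6 * numIntersecting S V + 2 * (3 * p) * (3 * p) + 3 * p ≤ 3 * (3 * p) * suc n
  bound = subst (λ m → 6 * numIntersecting S V + 2 * m * m + m ≤ 3 * m * suc n) ∣V∣≡3p (meeting-bound S V)
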